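{- Let $n\geq 4$, let $(\mathbf d,\mathbf r)$ be an arithmetical structure on $D_n$, and let $\ell=n-3$. Then (a) $\gcd(r_x,r_y)=1$, and (b) $\gcd(r_0,r_1)=r_\ell$.
   Context: The bident $D_n$ ($n\ge3$, $\ell=n-3$) has vertices $v_x,v_y,v_0,\dots,v_\ell$ and edges $v_xv_0$, $v_yv_0$, $v_iv_{i+1}$ ($0\le i\le\ell-1$). An arithmetical structure on $D_n$ is a pair $(\mathbf d,\mathbf r)$, $\mathbf d=(d_x,d_y,d_0,\dots,d_\ell)$, $\mathbf r=(r_x,r_y,r_0,\dots,r_\ell)$, of positive integer vectors with $(\operatorname{diag}(\mathbf d)-A)\mathbf r=\mathbf 0$ ($A$ the adjacency matrix) and the entries of $\mathbf r$ having no nontrivial common factor. -}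

module Defs where

open import Data.Nat using (ℕ; zero; suc; _+_; _*_; _∸_; _≤_; _<_; s≤s; z≤n; NonZero; >-nonZero)
open import Data.Nat.Properties using (≤-trans; n≤1+n)
open import Data.Nat.Divisibility using (_∣_)
open import Data.Fin using (Fin; toℕ; fromℕ<; fromℕ)
open import Data.List using (map; allFin)
open import Data.Nat.ListAction using (sum)
open import Data.Bool using (Bool; true; false; if_then_else_; _∨_)
open import Data.Nat using (_≡ᵇ_)
open import Relation.Binary.PropositionalEquality using (_≡_)
open import Data.Product using (_×_)

-- Vertex encoding of the bident D_n on vertex set Fin n:
--   index 0 = v_x, index 1 = v_y, index (2 + i) = v_i  (0 ≤ i ≤ ℓ = n - 3).
-- Edges: v_x v_0, v_y v_0, v_i v_{i+1}.

adjℕ : ℕ → ℕ → ℕ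
adjℕ 0 2 = 1
adjℕ 1 2 = 1
adjℕ 2 0 = 1
adjℕ 2 1 = 1
adjℕ (suc (suc a)) (suc (suc b)) =
  if ((suc a ≡ᵇ b) ∨ (suc b ≡ᵇ a)) then 1 else 0
adjℕ _ _ = 0

adjD : (n : ℕ) → Fin n → Fin n → ℕ
adjD n i j = adjℕ (toℕ i) (toℕ j)

Ar : (n : ℕ) → (Fin n → ℕ) → Fin n → ℕ
Ar n r v = sum (map (λ w → adjD n v w * r w) (allFin n))

record IsArithStruct (n : ℕ) (d r : Fin n → ℕ) : Set where
  field
    d-pos    : ∀ v → 1 ≤ d v
    r-pos    : ∀ v → 1 ≤ r v
    balanced : ∀ v → d v * r v ≡ Ar n r v
    r-primitive : ∀ k → (∀ v → k ∣ r v) → k ≡ 1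

lastV : (n : ℕ) → 0 < n → Fin n
lastV (suc m) _ = fromℕ m

module _ {n : ℕ} (h : 4 ≤ n) where
  private
    3<n : 3 < n
    3<n = h
    2<n : 2 < n
    2<n = ≤-trans (n≤1+n 3) h
    1<n : 1 < n
    1<n = ≤-trans (n≤1+n 2) 2<n
    0<n : 0 < n
    0<n = ≤-trans (n≤1+n 1) 1<n

  vx vy v0 v1 vℓ : Fin n
  vx = fromℕ< 0<n
  vy = fromℕ< 1<n
  v0 = fromℕ< 2<n
  v1 = fromℕ< 3<n
  -- v_ℓ with ℓ = n - 3 has index 2 + ℓ = n - 1
  vℓ = lastV n 0<n

-- Each vertex equation d_v r_v = Σ_{w ~ v} r_w says that r_v divides the sum
-- of its neighbours' entries; on the path, r_{i+1} ∣ r_i + r_{i+2}.  So one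
-- Euclidean step gives gcd (r_i, r_{i+1}) = gcd (r_{i+1}, r_{i+2}), and setting
-- r_{ℓ+1} = 0 the chain ends in gcd (r_ℓ, 0) = r_ℓ, which is (b).  For (a), a
-- common divisor of r_x and r_y divides r_0 (a multiple of r_x), then r_1 (by
-- the equation at v_0), hence every gcd (r_i, r_{i+1}) and so every entry of r.
module Submission where

open import Defs
open import Data.Nat using (ℕ; zero; suc; _+_; _*_; _≤_; _<_; s≤s; z≤n; _<?_; _≤?_)
open import Data.Nat.Properties
  using (+-identityʳ; +-comm; +-commutativeSemigroup; ≤-refl; <⇒≱; ≰⇒>; ≮⇒≥; <-≤-trans)
open import Data.Nat.Divisibility
  using (_∣_; divides; ∣-trans; ∣-antisym; ∣m+n∣m⇒∣n; _∣0)
open import Data.Nat.GCD using (gcd; gcd[m,n]∣m; gcd[m,n]∣n; gcd-greatest; gcd-identityʳ)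
open import Data.Fin using (Fin; zero; suc; toℕ; fromℕ<; fromℕ)
open import Data.Fin.Properties using (toℕ<n; fromℕ<-toℕ; toℕ-fromℕ<; toℕ-fromℕ)
open import Data.List using (tabulate)
open import Data.List.Properties using (map-tabulate)
open import Data.Nat.ListAction using (sum)
open import Data.Product using (_×_; _,_)
open import Function using (id; _∘_)
open import Relation.Binary.PropositionalEquality
  using (_≡_; refl; sym; trans; cong; cong₂; subst; module ≡-Reasoning)
open import Relation.Nullary using (yes; no)
open import Relation.Nullary.Negation using (contradiction)
open import Algebra.Properties.CommutativeSemigroup +-commutativeSemigroup using (interchange)

sumBelow : ℕ → (ℕ → ℕ) → ℕ
sumBelow zero    f = 0
sumBelow (suc n) f = f 0 + sumBelow n (f ∘ suc)

sumBelow-cong : ∀ n {f g : ℕ → ℕ} → (∀ j → f j ≡ g j) → sumBelow n f ≡ sumBelow n g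
sumBelow-cong zero    f≗g = refl
sumBelow-cong (suc n) f≗g = cong₂ _+_ (f≗g 0) (sumBelow-cong n (f≗g ∘ suc))

sumBelow-+ : ∀ n (f g : ℕ → ℕ) → sumBelow n (λ j → f j + g j) ≡ sumBelow n f + sumBelow n g
sumBelow-+ zero    f g = refl
sumBelow-+ (suc n) f g = trans (cong (f 0 + g 0 +_) (sumBelow-+ n (f ∘ suc) (g ∘ suc)))
                               (interchange (f 0) (g 0) _ _)

sumBelow-const-0 : ∀ n → sumBelow n (λ _ → 0) ≡ 0
sumBelow-const-0 zero    = refl
sumBelow-const-0 (suc n) = sumBelow-const-0 n

sum-tabulate : ∀ n (f : Fin n → ℕ) (g : ℕ → ℕ) → (∀ i → f i ≡ g (toℕ i)) →
               sum (tabulate f) ≡ sumBelow n g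
sum-tabulate zero    f g f≗g = refl
sum-tabulate (suc n) f g f≗g = cong₂ _+_ (f≗g zero) (sum-tabulate n (f ∘ suc) (g ∘ suc) (f≗g ∘ suc))

pointMass : ℕ → ℕ → ℕ → ℕ
pointMass zero    x zero    = x
pointMass zero    x (suc j) = 0
pointMass (suc a) x zero    = 0
pointMass (suc a) x (suc j) = pointMass a x j

sumBelow-pointMass : ∀ n a x → a < n → sumBelow n (pointMass a x) ≡ x
sumBelow-pointMass (suc n) zero    x _         = trans (cong (x +_) (sumBelow-const-0 n)) (+-identityʳ x)
sumBelow-pointMass (suc n) (suc a) x (s≤s a<n) = sumBelow-pointMass n a x a<n

sumBelow-pointMass-≥ : ∀ n a x → n ≤ a → sumBelow n (pointMass a x) ≡ 0
sumBelow-pointMass-≥ zero    a       x _         = refl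
sumBelow-pointMass-≥ (suc n) (suc a) x (s≤s n≤a) = sumBelow-pointMass-≥ n a x n≤a

-- Extended by zeros, r makes v_ℓ satisfy the equation of an interior path
-- vertex, with the missing neighbour v_{ℓ+1} carrying 0.
zeroExtend : ∀ {n} → (Fin n → ℕ) → ℕ → ℕ
zeroExtend {n} r j with j <? n
... | yes j<n = r (fromℕ< j<n)
... | no  _   = 0

zeroExtend-fromℕ< : ∀ {n} (r : Fin n → ℕ) {j} (j<n : j < n) → zeroExtend r j ≡ r (fromℕ< j<n)
zeroExtend-fromℕ< {n} r {j} j<n with j <? n
... | yes _   = refl
... | no  j≮n = contradiction j<n j≮n

zeroExtend-≥ : ∀ {n} (r : Fin n → ℕ) {j} → n ≤ j → zeroExtend r j ≡ 0
zeroExtend-≥ {n} r {j} n≤j with j <? n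
... | yes j<n = contradiction n≤j (<⇒≱ j<n)
... | no  _   = refl

zeroExtend-toℕ : ∀ {n} (r : Fin n → ℕ) (i : Fin n) → zeroExtend r (toℕ i) ≡ r i
zeroExtend-toℕ r i = trans (zeroExtend-fromℕ< r (toℕ<n i)) (cong r (fromℕ<-toℕ i (toℕ<n i)))

sumBelow-pointMass-zeroExtend : ∀ {n} (r : Fin n → ℕ) a →
                                sumBelow n (pointMass a (zeroExtend r a)) ≡ zeroExtend r a
sumBelow-pointMass-zeroExtend {n} r a with a <? n
... | yes a<n = sumBelow-pointMass n a _ a<n
... | no  a≮n = sumBelow-pointMass-≥ n a 0 (≮⇒≥ a≮n)

Ar-sumBelow : ∀ n (r : Fin n → ℕ) (v : Fin n) →
              Ar n r v ≡ sumBelow n (λ j → adjℕ (toℕ v) j * zeroExtend r j)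
Ar-sumBelow n r v = trans (cong sum (map-tabulate {n = n} id (λ w → adjD n v w * r w)))
  (sum-tabulate n _ _ (λ w → cong (adjℕ (toℕ v) (toℕ w) *_) (sym (zeroExtend-toℕ r w))))

adjℕ-vx : ∀ (f : ℕ → ℕ) j → adjℕ 0 j * f j ≡ pointMass 2 (f 2) j
adjℕ-vx f 0                   = refl
adjℕ-vx f 1                   = refl
adjℕ-vx f 2                   = +-identityʳ (f 2)
adjℕ-vx f (suc (suc (suc j))) = refl

adjℕ-v0 : ∀ (f : ℕ → ℕ) j →
          adjℕ 2 j * f j ≡ pointMass 0 (f 0) j + (pointMass 1 (f 1) j + pointMass 3 (f 3) j)
adjℕ-v0 f 0                         = refl
adjℕ-v0 f 1                         = refl
adjℕ-v0 f 2                         = refl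
adjℕ-v0 f 3                         = +-identityʳ (f 3)
adjℕ-v0 f (suc (suc (suc (suc j)))) = refl

adjℕ-path-on-path : ∀ (g : ℕ → ℕ) m b →
                    adjℕ (3 + m) (2 + b) * g b ≡ pointMass m (g m) b + pointMass (2 + m) (g (2 + m)) b
adjℕ-path-on-path g zero    0                   = refl
adjℕ-path-on-path g zero    1                   = refl
adjℕ-path-on-path g zero    2                   = +-identityʳ (g 2)
adjℕ-path-on-path g zero    (suc (suc (suc b))) = refl
adjℕ-path-on-path g (suc m) zero                = refl
adjℕ-path-on-path g (suc m) (suc b)             = adjℕ-path-on-path (g ∘ suc) m b

adjℕ-path : ∀ (f : ℕ → ℕ) m j →
            adjℕ (3 + m) j * f j ≡ pointMass (2 + m) (f (2 + m)) j + pointMass (4 + m) (f (4 + m)) j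
adjℕ-path f m 0             = refl
adjℕ-path f m 1             = refl
adjℕ-path f m (suc (suc b)) = adjℕ-path-on-path (λ b → f (2 + b)) m b

gcd-euclid-step : ∀ {a b c} → b ∣ a + c → gcd a b ≡ gcd b c
gcd-euclid-step {a} {b} {c} b∣a+c = ∣-antisym
  (gcd-greatest (gcd[m,n]∣n a b) (∣m+n∣m⇒∣n (∣-trans (gcd[m,n]∣n a b) b∣a+c) (gcd[m,n]∣m a b)))
  (gcd-greatest
    (∣m+n∣m⇒∣n (subst (gcd b c ∣_) (+-comm a c) (∣-trans (gcd[m,n]∣m b c) b∣a+c)) (gcd[m,n]∣n b c))
    (gcd[m,n]∣m b c))

gcd-invariant : ∀ k (a : ℕ → ℕ) → (∀ i → i < k → a (suc i) ∣ a i + a (suc (suc i))) →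
                gcd (a 0) (a 1) ≡ gcd (a k) (a (suc k))
gcd-invariant zero    a step = refl
gcd-invariant (suc k) a step =
  trans (gcd-euclid-step (step 0 (s≤s z≤n))) (gcd-invariant k (a ∘ suc) (λ i i<k → step (suc i) (s≤s i<k)))

gcd-∣-path : ∀ k (a : ℕ → ℕ) → (∀ i → i < k → a (suc i) ∣ a i + a (suc (suc i))) →
             ∀ {i} → i ≤ k → gcd (a 0) (a 1) ∣ a i
gcd-∣-path k a step {i} i≤k =
  subst (_∣ a i) (sym (gcd-invariant i a (λ j j<i → step j (<-≤-trans j<i i≤k)))) (gcd[m,n]∣m (a i) (a (suc i)))

module _ {n : ℕ} {d r : Fin n → ℕ} (S : IsArithStruct n d r) where
  open IsArithStruct S using (balanced)

  zeroExtend-∣-neighbourSum : ∀ {a} → a < n →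
                              zeroExtend r a ∣ sumBelow n (λ j → adjℕ a j * zeroExtend r j)
  zeroExtend-∣-neighbourSum {a} a<n = divides (d v) (begin
    sumBelow n (λ j → adjℕ a j * zeroExtend r j)        ≡⟨ cong (λ b → sumBelow n (λ j → adjℕ b j * zeroExtend r j)) (toℕ-fromℕ< a<n) ⟨
    sumBelow n (λ j → adjℕ (toℕ v) j * zeroExtend r j)  ≡⟨ Ar-sumBelow n r v ⟨
    Ar n r v                                            ≡⟨ balanced v ⟨
    d v * r v                                           ≡⟨ cong (d v *_) (zeroExtend-fromℕ< r a<n) ⟨
    d v * zeroExtend r a                                ∎)
    where
    open ≡-Reasoning
    v : Fin n
    v = fromℕ< a<n

module _ {t : ℕ} {d r : Fin (4 + t) → ℕ} (S : IsArithStruct (4 + t) d r) where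
  private
    R : ℕ → ℕ
    R = zeroExtend r

    mass : ℕ → ℕ → ℕ
    mass a = pointMass a (R a)

    sumBelow-mass : ∀ a → sumBelow (4 + t) (mass a) ≡ R a
    sumBelow-mass = sumBelow-pointMass-zeroExtend r

    sumBelow-mass₂ : ∀ a b → sumBelow (4 + t) (λ j → mass a j + mass b j) ≡ R a + R b
    sumBelow-mass₂ a b = trans (sumBelow-+ (4 + t) (mass a) (mass b)) (cong₂ _+_ (sumBelow-mass a) (sumBelow-mass b))

  vx-balanced : R 0 ∣ R 2
  vx-balanced = subst (R 0 ∣_) (trans (sumBelow-cong (4 + t) (adjℕ-vx R)) (sumBelow-mass 2))
                      (zeroExtend-∣-neighbourSum S (s≤s z≤n))

  v0-balanced : R 2 ∣ R 0 + (R 1 + R 3)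
  v0-balanced = subst (R 2 ∣_) (begin
    sumBelow (4 + t) (λ j → adjℕ 2 j * R j)                        ≡⟨ sumBelow-cong (4 + t) (adjℕ-v0 R) ⟩
    sumBelow (4 + t) (λ j → mass 0 j + (mass 1 j + mass 3 j))      ≡⟨ sumBelow-+ (4 + t) (mass 0) (λ j → mass 1 j + mass 3 j) ⟩
    sumBelow (4 + t) (mass 0) + sumBelow (4 + t) (λ j → mass 1 j + mass 3 j)
                                                                   ≡⟨ cong₂ _+_ (sumBelow-mass 0) (sumBelow-mass₂ 1 3) ⟩
    R 0 + (R 1 + R 3)                                              ∎)
    (zeroExtend-∣-neighbourSum S (s≤s (s≤s (s≤s z≤n))))
    where open ≡-Reasoning

  path-balanced : ∀ i → i < suc t → R (3 + i) ∣ R (2 + i) + R (4 + i)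
  path-balanced i i<ℓ = subst (R (3 + i) ∣_)
    (trans (sumBelow-cong (4 + t) (adjℕ-path R i)) (sumBelow-mass₂ (2 + i) (4 + i)))
    (zeroExtend-∣-neighbourSum S (s≤s (s≤s (s≤s i<ℓ))))

  gcd[r₀,r₁]≡rℓ : gcd (R 2) (R 3) ≡ R (3 + t)
  gcd[r₀,r₁]≡rℓ = begin
    gcd (R 2) (R 3)              ≡⟨ gcd-invariant (suc t) (λ i → R (2 + i)) path-balanced ⟩
    gcd (R (3 + t)) (R (4 + t))  ≡⟨ cong (gcd (R (3 + t))) (zeroExtend-≥ r ≤-refl) ⟩
    gcd (R (3 + t)) 0            ≡⟨ gcd-identityʳ (R (3 + t)) ⟩
    R (3 + t)                    ∎
    where open ≡-Reasoning

  gcd[rx,ry]≡1 : gcd (R 0) (R 1) ≡ 1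
  gcd[rx,ry]≡1 = r-primitive g (λ v → subst (g ∣_) (zeroExtend-toℕ r v) (g∣R (toℕ v)))
    where
    open IsArithStruct S using (r-primitive)
    g : ℕ
    g = gcd (R 0) (R 1)
    g∣R2 : g ∣ R 2
    g∣R2 = ∣-trans (gcd[m,n]∣m (R 0) (R 1)) vx-balanced
    g∣R3 : g ∣ R 3
    g∣R3 = ∣m+n∣m⇒∣n (∣m+n∣m⇒∣n (∣-trans g∣R2 v0-balanced) (gcd[m,n]∣m (R 0) (R 1))) (gcd[m,n]∣n (R 0) (R 1))
    g∣R : ∀ j → g ∣ R j
    g∣R 0 = gcd[m,n]∣m (R 0) (R 1)
    g∣R 1 = gcd[m,n]∣n (R 0) (R 1)
    g∣R (suc (suc i)) with i ≤? suc t
    ... | yes i≤ℓ = ∣-trans (gcd-greatest g∣R2 g∣R3) (gcd-∣-path (suc t) (λ i → R (2 + i)) path-balanced i≤ℓ)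
    ... | no  i≰ℓ = subst (g ∣_) (sym (zeroExtend-≥ r (s≤s (s≤s (≰⇒> i≰ℓ))))) (g ∣0)

lemma2p5 : (n : ℕ) (h : 4 ≤ n) (d r : Fin n → ℕ) → IsArithStruct n d r →
    (gcd (r (vx h)) (r (vy h)) ≡ 1) × (gcd (r (v0 h)) (r (v1 h)) ≡ r (vℓ h))
lemma2p5 (suc (suc (suc (suc t)))) (s≤s (s≤s (s≤s (s≤s _)))) d r S =
    trans (cong₂ gcd (sym (zeroExtend-fromℕ< r 0<n)) (sym (zeroExtend-fromℕ< r 1<n))) (gcd[rx,ry]≡1 S)
  , trans (cong₂ gcd (sym (zeroExtend-fromℕ< r 2<n)) (sym (zeroExtend-fromℕ< r 3<n)))
          (trans (gcd[r₀,r₁]≡rℓ S) rℓ≡)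
  where
  0<n : 0 < 4 + t
  0<n = s≤s z≤n
  1<n : 1 < 4 + t
  1<n = s≤s (s≤s z≤n)
  2<n : 2 < 4 + t
  2<n = s≤s (s≤s (s≤s z≤n))
  3<n : 3 < 4 + t
  3<n = s≤s (s≤s (s≤s (s≤s z≤n)))
  rℓ≡ : zeroExtend r (3 + t) ≡ r (fromℕ (3 + t))
  rℓ≡ = trans (cong (zeroExtend r) (sym (toℕ-fromℕ (3 + t)))) (zeroExtend-toℕ r (fromℕ (3 + t)))
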